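{- In Single-delete Nim with $n\geq 2$ piles, a position $\langle x_1,x_2,\ldots,x_n\rangle$ in which every $x_i$ is odd is a P-position.
   Context: Single-delete Nim with $n\geq 2$ piles: a position is $n$ piles of stones with positive sizes $\langle x_1,\ldots,x_n\rangle$. Two players alternate; a move consists of removing one pile entirely and then splitting one of the remaining $n-1$ piles into two piles each with at least one stone. A player unable to move loses. A P-position is one from which the player to move loses under optimal play by both players. -}

module Defs where

open import Data.Nat using (ℕ; suc; _+_; _*_)
open import Data.Fin using (Fin)
open import Data.Vec using (Vec; _∷_; lookup; removeAt)
open import Data.Product using (Σ)
open import Relation.Binary.PropositionalEquality using (_≡_)

Odd : ℕ → Set
Odd x = Σ ℕ (λ k → x ≡ 1 + 2 * k)

-- The resulting pile list puts the two new piles in front (pile order is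
-- irrelevant to the game).
data Move {m : ℕ} : Vec ℕ (2 + m) → Vec ℕ (2 + m) → Set where
  move : (xs : Vec ℕ (2 + m)) (i : Fin (2 + m)) (j : Fin (1 + m)) (a b : ℕ) →
         lookup (removeAt xs i) j ≡ suc a + suc b →
         Move xs (suc a ∷ suc b ∷ removeAt (removeAt xs i) j)

mutual
  data PPos {m : ℕ} (xs : Vec ℕ (2 + m)) : Set where
    ppos : (∀ ys → Move xs ys → NPos ys) → PPos xs

  data NPos {m : ℕ} (xs : Vec ℕ (2 + m)) : Set where
    npos : (ys : Vec ℕ (2 + m)) → Move xs ys → PPos ys → NPos xs

{-# OPTIONS --safe #-}
-- After any move from a position whose piles are all odd, the pile that was
-- split was odd, so one of its two parts is odd and the other even. Answer by
-- deleting the odd part and splitting the even part e into 1 and e - 1: all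
-- piles are odd again and the total number of stones has decreased.
module Submission where

open import Defs
open import Data.Nat using (ℕ; zero; suc; _+_; _*_; _≤_; _<_; z≤n; s≤s)
open import Data.Nat.Properties
  using (+-assoc; +-suc; *-distribˡ-+; suc-injective; even≢odd;
         ≤-trans; ≤-reflexive; <-≤-trans; m≤n+m; m<n+m; +-commutativeSemigroup)
open import Algebra.Properties.CommutativeSemigroup +-commutativeSemigroup
  using (x∙yz≈y∙xz)
open import Data.Nat.Induction using (<-wellFounded)
open import Data.Fin using (Fin; zero; suc)
open import Data.Vec using (Vec; _∷_; lookup; removeAt; sum)
open import Data.Vec.Relation.Unary.All using (All; _∷_)
open import Data.Vec.Relation.Unary.All.Properties using (lookup⁺)
open import Data.Product using (Σ; ∃-syntax; _×_; _,_)
open import Data.Sum using (_⊎_; inj₁; inj₂)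
open import Data.Empty using (⊥-elim)
open import Induction.WellFounded using (Acc; acc)
open import Relation.Binary.PropositionalEquality
  using (_≡_; refl; sym; trans; cong; subst; module ≡-Reasoning)

private
  variable
    m n : ℕ

Even : ℕ → Set
Even x = Σ ℕ (λ k → x ≡ 2 * k)

even-or-odd : ∀ n → Even n ⊎ Odd n
even-or-odd zero = inj₁ (0 , refl)
even-or-odd (suc n) with even-or-odd n
... | inj₁ (k , n≡2k)   = inj₂ (k , cong suc n≡2k)
... | inj₂ (k , n≡1+2k) = inj₁ (suc k , cong suc (trans n≡1+2k (sym (+-suc k (k + 0)))))

odd-+ : ∀ x y → Odd (x + y) → Odd x ⊎ Odd y
odd-+ x y (k , x+y≡1+2k) with even-or-odd x | even-or-odd y
... | inj₂ odd-x       | _               = inj₁ odd-x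
... | inj₁ _          | inj₂ odd-y      = inj₂ odd-y
... | inj₁ (t , refl) | inj₁ (u , refl) = ⊥-elim (even≢odd (t + u) k (begin
  2 * (t + u)     ≡⟨ *-distribˡ-+ 2 t u ⟩
  2 * t + 2 * u   ≡⟨ x+y≡1+2k ⟩
  suc (2 * k)     ∎))
  where open ≡-Reasoning

odd-suc-suc : ∀ n → Odd (suc (suc n)) → Odd n
odd-suc-suc n (zero  , ())
odd-suc-suc n (suc k , 2+n≡3+2k) =
  k , suc-injective (suc-injective (trans 2+n≡3+2k (cong (2 +_) (+-suc k (k + 0)))))

removeAt⁺ : ∀ {P : ℕ → Set} {xs : Vec ℕ (suc n)} (i : Fin (suc n)) →
            All P xs → All P (removeAt xs i)
removeAt⁺ zero    (px ∷ pxs)         = pxs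
removeAt⁺ (suc i) (px ∷ pxs@(_ ∷ _)) = px ∷ removeAt⁺ i pxs

sum-removeAt : (xs : Vec ℕ (suc n)) (i : Fin (suc n)) →
               lookup xs i + sum (removeAt xs i) ≡ sum xs
sum-removeAt (x ∷ xs)     zero    = refl
sum-removeAt (x ∷ y ∷ xs) (suc i) = begin
  lookup (y ∷ xs) i + (x + sum (removeAt (y ∷ xs) i))  ≡⟨ x∙yz≈y∙xz (lookup (y ∷ xs) i) x _ ⟩
  x + (lookup (y ∷ xs) i + sum (removeAt (y ∷ xs) i))  ≡⟨ cong (x +_) (sum-removeAt (y ∷ xs) i) ⟩
  x + sum (y ∷ xs)                                      ∎
  where open ≡-Reasoning

sum-split : (xs : Vec ℕ (suc n)) (j : Fin (suc n)) (a b : ℕ) →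
            lookup xs j ≡ a + b → sum (a ∷ b ∷ removeAt xs j) ≡ sum xs
sum-split xs j a b xⱼ≡a+b = begin
  a + (b + sum (removeAt xs j))      ≡⟨ +-assoc a b _ ⟨
  a + b + sum (removeAt xs j)        ≡⟨ cong (_+ sum (removeAt xs j)) xⱼ≡a+b ⟨
  lookup xs j + sum (removeAt xs j)  ≡⟨ sum-removeAt xs j ⟩
  sum xs                             ∎
  where open ≡-Reasoning

sum-move : (xs : Vec ℕ (2 + m)) (i : Fin (2 + m)) (j : Fin (1 + m)) (a b : ℕ) →
           lookup (removeAt xs i) j ≡ suc a + suc b →
           lookup xs i + sum (suc a ∷ suc b ∷ removeAt (removeAt xs i) j) ≡ sum xs
sum-move xs i j a b eq = begin
  lookup xs i + sum (suc a ∷ suc b ∷ removeAt (removeAt xs i) j)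
    ≡⟨ cong (lookup xs i +_) (sum-split (removeAt xs i) j (suc a) (suc b) eq) ⟩
  lookup xs i + sum (removeAt xs i)
    ≡⟨ sum-removeAt xs i ⟩
  sum xs
    ∎
  where open ≡-Reasoning

Move⇒sum≤ : {xs ys : Vec ℕ (2 + m)} → Move xs ys → sum ys ≤ sum xs
Move⇒sum≤ (move xs i j a b eq) =
  ≤-trans (m≤n+m _ (lookup xs i)) (≤-reflexive (sum-move xs i j a b eq))

reply-invariant⇒PPos : (P : Vec ℕ (2 + m) → Set) (μ : Vec ℕ (2 + m) → ℕ) →
  (∀ {xs ys} → P xs → Move xs ys → ∃[ zs ] Move ys zs × P zs × μ zs < μ xs) →
  ∀ xs → P xs → PPos xs
reply-invariant⇒PPos P μ reply xs = go xs (<-wellFounded (μ xs))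
  where
  go : ∀ xs → Acc _<_ (μ xs) → P xs → PPos xs
  go xs (acc rec) pxs = ppos respond
    where
    respond : ∀ ys → Move xs ys → NPos ys
    respond ys xs→ys with reply pxs xs→ys
    ... | zs , ys→zs , pzs , μzs<μxs = npos zs ys→zs (go zs (rec μzs<μxs) pzs)

restoreOdd : (p q : ℕ) (rest : Vec ℕ m) → All Odd rest → Odd p ⊎ Odd q →
  let ys = suc p ∷ suc q ∷ rest in
  ∃[ zs ] Move ys zs × All Odd zs × sum zs < sum ys
restoreOdd p q rest odds (inj₁ (s , refl)) =
  1 ∷ suc (2 * s) ∷ rest ,
  move ys (suc zero) zero 0 (2 * s) refl ,
  (0 , refl) ∷ (s , refl) ∷ odds ,
  <-≤-trans (m<n+m _ (s≤s z≤n)) (≤-reflexive (sum-move ys (suc zero) zero 0 (2 * s) refl))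
  where ys = suc p ∷ suc q ∷ rest
restoreOdd p q rest odds (inj₂ (s , refl)) =
  1 ∷ suc (2 * s) ∷ rest ,
  move ys zero zero 0 (2 * s) refl ,
  (0 , refl) ∷ (s , refl) ∷ odds ,
  <-≤-trans (m<n+m _ (s≤s z≤n)) (≤-reflexive (sum-move ys zero zero 0 (2 * s) refl))
  where ys = suc p ∷ suc q ∷ rest

oddReply : {xs ys : Vec ℕ (2 + m)} → All Odd xs → Move xs ys →
           ∃[ zs ] Move ys zs × All Odd zs × sum zs < sum xs
oddReply odds xs→ys@(move xs i j a b eq) =
  let zs , ys→zs , odd-zs , zs<ys = restoreOdd a b _ (removeAt⁺ j (removeAt⁺ i odds)) (odd-+ a b odd-a+b)
  in  zs , ys→zs , odd-zs , <-≤-trans zs<ys (Move⇒sum≤ xs→ys)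
  where
  odd-a+b : Odd (a + b)
  odd-a+b = odd-suc-suc (a + b) (subst Odd (trans eq (cong suc (+-suc a b))) (lookup⁺ (removeAt⁺ i odds) j))

proposition4p1 : (m : ℕ) (xs : Vec ℕ (2 + m)) → All Odd xs → PPos xs
proposition4p1 m = reply-invariant⇒PPos (All Odd) sum oddReply
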